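{- Let $\mathbb{K}$ be a field of characteristic zero, $n\ge1$, and $M\in M_n(\mathbb{K})$. Then the subspace $\Delta(M)\subseteq \mathbb{K}[x_1,\dots,x_n]$ is graded.
   Context: Let $M=(M_{ij})$ with $i$-th row $M_i$. For $i\in[n]$ define $\Delta_i(p(\mathbf{x}))=p(\mathbf{x}-M_i)-p(\mathbf{x})$, where $\mathbf{x}-M_i=(x_1-M_{i1},\dots,x_n-M_{in})$. Define $\Delta(M)=\bigcap_{i=1}^n\{p\in\mathbb{K}[\mathbf{x}] : \frac{\partial}{\partial x_i}\Delta_i(p)=0\}$, i.e. the polynomials $p$ such that $\Delta_i(p)$ does not involve $x_i$ for every $i$. A subspace $U\subseteq\mathbb{K}[\mathbf{x}]$ is graded if whenever $p\in U$, every homogeneous component $p_m$ (the degree-$m$ part of $p$) also lies in $U$. -}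

module Defs where

open import Level using (Level; _⊔_)
open import Algebra.Bundles using (CommutativeRing)
open import Data.Nat as ℕ using (ℕ; zero; suc)
open import Data.Fin using (Fin)
open import Data.Vec as Vec using (Vec; lookup; _[_]≔_; replicate; tabulate; allFin)
open import Data.Vec.Properties using (≡-dec)
open import Data.List as List using (List; []; _∷_; _++_; map; concatMap; foldr; filterᵇ)
open import Data.Product using (_×_; _,_; proj₁; proj₂)
open import Data.Bool using (Bool; true; false; if_then_else_)
open import Relation.Nullary using (¬_; does)
open import Relation.Nullary.Decidable using (⌊_⌋)

record Field (c ℓ : Level) : Set (Level.suc (c ⊔ ℓ)) where
  field
    commRing : CommutativeRing c ℓ
  open CommutativeRing commRing public
  field
    1≉0     : ¬ (1# ≈ 0#)
    inverse : ∀ x → ¬ (x ≈ 0#) → Data.Product.Σ Carrier (λ y → (x * y) ≈ 1#)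

module FieldOps {c ℓ : Level} (F : Field c ℓ) where
  open Field F

  natMul : ℕ → Carrier → Carrier
  natMul zero    a = 0#
  natMul (suc k) a = a + natMul k a

  CharZero : Set ℓ
  CharZero = ∀ k → ¬ (natMul (suc k) 1# ≈ 0#)

  -- Polynomials in n variables: finite formal sums of terms  a · x^e,
  -- represented as lists of (coefficient, exponent vector).
  Poly : ℕ → Set c
  Poly n = List (Carrier × Vec ℕ n)

  coeff : ∀ {n} → Poly n → Vec ℕ n → Carrier
  coeff []             e = 0#
  coeff ((a , f) ∷ p) e =
    if does (≡-dec ℕ._≟_ f e) then a + coeff p e else coeff p e

  _≈P_ : ∀ {n} → Poly n → Poly n → Set ℓ
  p ≈P q = ∀ e → coeff p e ≈ coeff q e

  0P : ∀ {n} → Poly n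
  0P = []

  constP : ∀ {n} → Carrier → Poly n
  constP a = (a , replicate _ 0) ∷ []

  1P : ∀ {n} → Poly n
  1P = constP 1#

  var : ∀ {n} → Fin n → Poly n
  var {n} j = (1# , (replicate n 0 [ j ]≔ 1)) ∷ []

  _+P_ : ∀ {n} → Poly n → Poly n → Poly n
  _+P_ = _++_

  scaleP : ∀ {n} → Carrier → Poly n → Poly n
  scaleP a = map (λ { (b , e) → (a * b , e) })

  negP : ∀ {n} → Poly n → Poly n
  negP = scaleP (- 1#)

  _*P_ : ∀ {n} → Poly n → Poly n → Poly n
  p *P q = concatMap (λ { (a , e) → map (λ { (b , f) → (a * b , Vec.zipWith ℕ._+_ e f) }) q }) p

  _^P_ : ∀ {n} → Poly n → ℕ → Poly n
  p ^P zero    = 1P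
  p ^P (suc k) = p *P (p ^P k)

  -- substitution x ↦ x - v, i.e. p(x) ↦ p(x₁ - v₁, …, xₙ - vₙ)
  shiftMono : ∀ {n} → (Fin n → Carrier) → Carrier × Vec ℕ n → Poly n
  shiftMono {n} v (a , e) =
    scaleP a (foldr _*P_ 1P
      (List.map (λ j → (var j +P constP (- v j)) ^P lookup e j) (List.allFin n)))

  shiftP : ∀ {n} → (Fin n → Carrier) → Poly n → Poly n
  shiftP v p = concatMap (shiftMono v) p

  -- Δ_i(p)(x) = p(x - M_i) - p(x), M_i the i-th row of M
  Δ : ∀ {n} → (Fin n → Fin n → Carrier) → Fin n → Poly n → Poly n
  Δ M i p = shiftP (M i) p +P negP p

  derivMono : ∀ {n} → Fin n → Carrier × Vec ℕ n → Poly n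
  derivMono i (a , e) with lookup e i
  ... | zero  = []
  ... | suc k = (natMul (suc k) a , (e [ i ]≔ k)) ∷ []

  ∂ : ∀ {n} → Fin n → Poly n → Poly n
  ∂ i p = concatMap (derivMono i) p

  degree : ∀ {n} → Vec ℕ n → ℕ
  degree = Vec.sum

  homog : ∀ {n} → ℕ → Poly n → Poly n
  homog m = filterᵇ (λ t → ⌊ degree (proj₂ t) ℕ.≟ m ⌋)

  InΔ : ∀ {n} → (Fin n → Fin n → Carrier) → Poly n → Set ℓ
  InΔ M p = ∀ i → ∂ i (Δ M i p) ≈P 0P

  Graded : ∀ {n} → (Poly n → Set ℓ) → Set (c ⊔ ℓ)
  Graded U = ∀ p → U p → ∀ m → U (homog m p)

-- Put w = −Mᵢ and split p(x + w) = Σₖ Sₖ(p) by level: a monomial x^e coming from the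
-- monomial x^f of p has level |f| − |e|. Differentiating along w maps Sₖ(p) to
-- (k + 1)·Sₖ₊₁(p). Since ∂ᵢ commutes with shifts, p ∈ Δ(M) says that q = ∂ᵢp satisfies
-- Σ_{k≥1} Sₖ(q) = 0; differentiating this j times along w gives a triangular system in the
-- Sₖ(q) with diagonal entries (j + 1)!, so in characteristic zero Sₖ(q) = 0 for every k ≥ 1.
-- Taking a homogeneous component commutes with ∂ᵢ up to a degree shift and only selects
-- levels, so every component of p inherits the condition. Levels are handled through
-- weight functions φ on ℕ (shiftCoeff), which avoids dividing by factorials.
module Submission where

open import Defs
open import Data.Nat using (ℕ; _≤_)
open import Data.Fin using (Fin)

open import Level using (_⊔_)
open import Algebra.Bundles using (Semiring)
open import Data.Empty using (⊥-elim)
open import Data.Fin using (zero; suc; punchIn)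
open import Data.Fin.Properties using (punchInᵢ≢i)
open import Data.List as List using ([]; _∷_; _++_)
import Data.List.Properties as List
open import Data.List.Relation.Unary.All using (All; []; _∷_)
import Data.List.Relation.Unary.All.Properties as All
open import Data.Nat as ℕ using (zero; suc; _∸_; _<_; s≤s; _!)
import Data.Nat.Properties as ℕ
import Data.Nat.ListAction as ℕ
open import Data.Nat.Combinatorics using (_C_; nCn≡1; nC1≡n; k>n⇒nCk≡0; nCk+nC[k+1]≡[n+1]C[k+1])
open import Data.Nat.Solver using (module +-*-Solver)
open import Algebra.Properties.CommutativeSemigroup ℕ.+-commutativeSemigroup using (interchange)
open import Data.Product using (_,_; proj₁; proj₂)
open import Data.Sum using (_⊎_; inj₁; inj₂)
open import Data.Vec as Vec using (Vec; []; _∷_; lookup; _[_]%=_; _[_]≔_)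
open import Data.Vec.Properties using (≡-dec; lookup∘updateAt; lookup∘updateAt′; zipWith-identityˡ)
open import Data.Vec.Functional using (removeAt)
open import Function using (id; _∘_)
open import Relation.Binary.Definitions using (tri<; tri≈; tri>)
open import Relation.Binary.PropositionalEquality as ≡ using (_≡_; _≢_)
open import Relation.Nullary using (¬_; Dec; yes; no)
open import Relation.Nullary.Decidable using (⌊_⌋; T?; fromWitness; toWitness)

module _ where
  open import Data.Nat using (_+_; _*_; z<s; s<s)
  open import Data.Nat.Properties
  open import Relation.Binary.PropositionalEquality
  open ≡-Reasoning

  [k+1]*[n+1]C[k+1]≡[n+1]*nCk : ∀ n k → suc k * (suc n C suc k) ≡ suc n * (n C k)
  [k+1]*[n+1]C[k+1]≡[n+1]*nCk n zero = begin
    1 * (suc n C 1) ≡⟨ *-identityˡ _ ⟩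
    suc n C 1       ≡⟨ nC1≡n (suc n) ⟩
    suc n           ≡⟨ *-identityʳ (suc n) ⟨
    suc n * 1       ∎
  [k+1]*[n+1]C[k+1]≡[n+1]*nCk zero (suc k) = begin
    suc (suc k) * (1 C suc (suc k)) ≡⟨ cong (suc (suc k) *_) (k>n⇒nCk≡0 {1} (s<s (z<s {k}))) ⟩
    suc (suc k) * 0                 ≡⟨ *-zeroʳ (suc (suc k)) ⟩
    0                               ≡⟨ cong (1 *_) (k>n⇒nCk≡0 {0} (z<s {k})) ⟨
    1 * (0 C suc k)                 ∎
  [k+1]*[n+1]C[k+1]≡[n+1]*nCk (suc n) (suc k) = begin
    (2 + k) * (suc (suc n) C suc (suc k))
      ≡⟨ cong ((2 + k) *_) (nCk+nC[k+1]≡[n+1]C[k+1] (suc n) (suc k)) ⟨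
    (2 + k) * (c + d)
      ≡⟨ solve 3 (λ k c d → (con 2 :+ k) :* (c :+ d) := (con 1 :+ k) :* c :+ c :+ (con 2 :+ k) :* d)
                 refl k c d ⟩
    (1 + k) * c + c + (2 + k) * d
      ≡⟨ cong₂ (λ x y → x + c + y) ([k+1]*[n+1]C[k+1]≡[n+1]*nCk n k) ([k+1]*[n+1]C[k+1]≡[n+1]*nCk n (suc k)) ⟩
    (1 + n) * a + c + (1 + n) * b
      ≡⟨ cong (λ x → (1 + n) * a + x + (1 + n) * b) (nCk+nC[k+1]≡[n+1]C[k+1] n k) ⟨
    (1 + n) * a + (a + b) + (1 + n) * b
      ≡⟨ solve 3 (λ n a b → (con 1 :+ n) :* a :+ (a :+ b) :+ (con 1 :+ n) :* b := (con 2 :+ n) :* (a :+ b))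
                 refl n a b ⟩
    (2 + n) * (a + b)
      ≡⟨ cong ((2 + n) *_) (nCk+nC[k+1]≡[n+1]C[k+1] n k) ⟩
    (2 + n) * c ∎
    where
    open +-*-Solver
    a = n C k
    b = n C suc k
    c = suc n C suc k
    d = suc n C suc (suc k)

  [k+1]*nC[k+1]≡[n∸k]*nCk : ∀ n k → suc k * (n C suc k) ≡ (n ∸ k) * (n C k)
  [k+1]*nC[k+1]≡[n∸k]*nCk n k = begin
    suc k * (n C suc k)                         ≡⟨ m+n∸m≡n (suc k * (n C k)) _ ⟨
    suc k * (n C k) + suc k * (n C suc k) ∸ suc k * (n C k)
      ≡⟨ cong (_∸ suc k * (n C k)) pascal ⟩
    suc n * (n C k) ∸ suc k * (n C k)           ≡⟨ *-distribʳ-∸ (n C k) (suc n) (suc k) ⟨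
    (n ∸ k) * (n C k)                           ∎
    where
    pascal : suc k * (n C k) + suc k * (n C suc k) ≡ suc n * (n C k)
    pascal = trans (sym (*-distribˡ-+ (suc k) (n C k) (n C suc k)))
      (trans (cong (suc k *_) (nCk+nC[k+1]≡[n+1]C[k+1] n k)) ([k+1]*[n+1]C[k+1]≡[n+1]*nCk n k))

gap : ∀ {n} → Vec ℕ n → Vec ℕ n → ℕ
gap f e = Vec.sum (Vec.zipWith _∸_ f e)

gap-self : ∀ {n} (e : Vec ℕ n) → gap e e ≡ 0
gap-self []      = ≡.refl
gap-self (x ∷ e) = ≡.cong₂ ℕ._+_ (ℕ.n∸n≡0 x) (gap-self e)

gap≤sum : ∀ {n} (f e : Vec ℕ n) → gap f e ≤ Vec.sum f
gap≤sum []      []      = ℕ.z≤n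
gap≤sum (F ∷ f) (x ∷ e) = ℕ.+-mono-≤ (ℕ.m∸n≤m F x) (gap≤sum f e)

gap-[]%=suc : ∀ {n} (f e : Vec ℕ n) i → lookup e i < lookup f i → suc (gap f (e [ i ]%= suc)) ≡ gap f e
gap-[]%=suc (F ∷ f) (x ∷ e) zero    x<F = ≡.cong (ℕ._+ gap f e) (≡.sym (ℕ.+-∸-assoc 1 x<F))
gap-[]%=suc (F ∷ f) (x ∷ e) (suc i) e<f =
  ≡.trans (≡.sym (ℕ.+-suc (F ∸ x) _)) (≡.cong ((F ∸ x) ℕ.+_) (gap-[]%=suc f e i e<f))

gap-[]≔ : ∀ {n} (f e : Vec ℕ n) i {k} → lookup f i ≡ suc k → gap (f [ i ]≔ k) e ≡ gap f (e [ i ]%= suc)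
gap-[]≔ (F ∷ f) (x ∷ e) zero    ≡.refl = ≡.refl
gap-[]≔ (F ∷ f) (x ∷ e) (suc i) fᵢ≡1+k = ≡.cong ((F ∸ x) ℕ.+_) (gap-[]≔ f e i fᵢ≡1+k)

zipWith-+-cancelˡ : ∀ {n} (g : Vec ℕ n) {f h} → Vec.zipWith ℕ._+_ g f ≡ Vec.zipWith ℕ._+_ g h → f ≡ h
zipWith-+-cancelˡ []      {[]}    {[]}    _  = ≡.refl
zipWith-+-cancelˡ (x ∷ g) {_ ∷ _} {_ ∷ _} eq =
  ≡.cong₂ _∷_ (ℕ.+-cancelˡ-≡ x _ _ (≡.cong Vec.head eq)) (zipWith-+-cancelˡ g (≡.cong Vec.tail eq))

AgreeOff : ∀ {n} → Fin n → Vec ℕ n → Vec ℕ n → Set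
AgreeOff i f f′ = ∀ j → j ≢ i → lookup f j ≡ lookup f′ j

agreeOff-refl : ∀ {n} i (f : Vec ℕ n) → AgreeOff i f f
agreeOff-refl i f j _ = ≡.refl

agreeOff-[]%= : ∀ {n} i (h : ℕ → ℕ) (f : Vec ℕ n) → AgreeOff i (f [ i ]%= h) f
agreeOff-[]%= i h f j j≢i = lookup∘updateAt′ j i j≢i f

module BinomialTerm {c ℓ} (R : Semiring c ℓ) where
  open Semiring R
  open import Algebra.Properties.Semiring.Mult R
  open import Algebra.Properties.Semiring.Exp R
  open import Relation.Binary.Reasoning.Setoid setoid

  binomialTerm : Carrier → ℕ → ℕ → Carrier
  binomialTerm y n k = (n C k) × y ^ (n ∸ k)

  binomialTerm-over : ∀ y {n k} → n < k → binomialTerm y n k ≈ 0#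
  binomialTerm-over y n<k = ×-congˡ (k>n⇒nCk≡0 n<k)

  binomialTerm-diag : ∀ y n → binomialTerm y n n ≈ 1#
  binomialTerm-diag y n = begin
    (n C n) × y ^ (n ∸ n) ≡⟨ ≡.cong₂ (λ a b → a × y ^ b) (nCn≡1 n) (ℕ.n∸n≡0 n) ⟩
    1 × 1#                ≈⟨ ×-homo-1 1# ⟩
    1#                    ∎

  y*binomialTerm[k+1] : ∀ y n k → y * binomialTerm y n (suc k) ≈ (n C suc k) × y ^ (n ∸ k)
  y*binomialTerm[k+1] y n k with k ℕ.<? n
  ... | yes k<n = begin
    y * ((n C suc k) × y ^ (n ∸ suc k)) ≈⟨ ×-comm-* (n C suc k) y _ ⟩
    (n C suc k) × y ^ suc (n ∸ suc k)   ≡⟨ ≡.cong (λ m → (n C suc k) × y ^ m) (ℕ.+-∸-assoc 1 k<n) ⟨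
    (n C suc k) × y ^ (n ∸ k)           ∎
  ... | no k≮n = begin
    y * binomialTerm y n (suc k) ≈⟨ *-congˡ (binomialTerm-over y (s≤s (ℕ.≮⇒≥ k≮n))) ⟩
    y * 0#                       ≈⟨ zeroʳ y ⟩
    0#                           ≈⟨ ×-congˡ (k>n⇒nCk≡0 (s≤s (ℕ.≮⇒≥ k≮n))) ⟨
    (n C suc k) × y ^ (n ∸ k)    ∎

  binomialTerm-suc-zero : ∀ y n → binomialTerm y (suc n) 0 ≈ y * binomialTerm y n 0
  binomialTerm-suc-zero y n = begin
    1 × (y * y ^ n)     ≈⟨ ×-comm-* 1 y (y ^ n) ⟨
    y * (1 × y ^ n)     ∎

  binomialTerm-suc-suc : ∀ y n k →
    binomialTerm y (suc n) (suc k) ≈ binomialTerm y n k + y * binomialTerm y n (suc k)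
  binomialTerm-suc-suc y n k = begin
    (suc n C suc k) × y ^ (n ∸ k)
      ≡⟨ ≡.cong (_× y ^ (n ∸ k)) (nCk+nC[k+1]≡[n+1]C[k+1] n k) ⟨
    (n C k ℕ.+ n C suc k) × y ^ (n ∸ k)
      ≈⟨ ×-homo-+ _ (n C k) (n C suc k) ⟩
    (n C k) × y ^ (n ∸ k) + (n C suc k) × y ^ (n ∸ k)
      ≈⟨ +-congˡ (y*binomialTerm[k+1] y n k) ⟨
    binomialTerm y n k + y * binomialTerm y n (suc k) ∎

  binomialTerm-lower : ∀ y n k →
    y * (suc k × binomialTerm y n (suc k)) ≈ (n ∸ k) × binomialTerm y n k
  binomialTerm-lower y n k = begin
    y * (suc k × binomialTerm y n (suc k))     ≈⟨ ×-comm-* (suc k) y _ ⟩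
    suc k × (y * binomialTerm y n (suc k))     ≈⟨ ×-congʳ (suc k) (y*binomialTerm[k+1] y n k) ⟩
    suc k × ((n C suc k) × y ^ (n ∸ k))        ≈⟨ ×-assocˡ _ (suc k) (n C suc k) ⟩
    (suc k ℕ.* (n C suc k)) × y ^ (n ∸ k)      ≡⟨ ≡.cong (_× y ^ (n ∸ k)) ([k+1]*nC[k+1]≡[n∸k]*nCk n k) ⟩
    ((n ∸ k) ℕ.* (n C k)) × y ^ (n ∸ k)        ≈⟨ ×-assocˡ _ (n ∸ k) (n C k) ⟨
    (n ∸ k) × binomialTerm y n k               ∎

  binomialTerm-raise : ∀ y n k →
    suc n × binomialTerm y n k ≈ suc k × binomialTerm y (suc n) (suc k)
  binomialTerm-raise y n k = begin
    suc n × ((n C k) × y ^ (n ∸ k))            ≈⟨ ×-assocˡ _ (suc n) (n C k) ⟩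
    (suc n ℕ.* (n C k)) × y ^ (n ∸ k)          ≡⟨ ≡.cong (_× y ^ (n ∸ k)) ([k+1]*[n+1]C[k+1]≡[n+1]*nCk n k) ⟨
    (suc k ℕ.* (suc n C suc k)) × y ^ (n ∸ k)  ≈⟨ ×-assocˡ _ (suc k) (suc n C suc k) ⟨
    suc k × binomialTerm y (suc n) (suc k)     ∎

module Lifting {c ℓ} (K : Field c ℓ) where
  open Field K using (Carrier; -_)
  open FieldOps K
  open ≡.≡-Reasoning

  *P-∷ : ∀ {n} t (P Q : Poly n) → (t ∷ P) *P Q ≡ ((t ∷ []) *P Q) +P (P *P Q)
  *P-∷ t P Q = ≡.cong (_++ (P *P Q)) (≡.sym (List.++-identityʳ _))

  liftP : ∀ {n} → Poly n → Poly (suc n)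
  liftP = List.map (λ t → proj₁ t , 0 ∷ proj₂ t)

  liftP-monomial*P : ∀ {n} a (g : Vec ℕ n) Q →
    liftP (((a , g) ∷ []) *P Q) ≡ ((a , 0 ∷ g) ∷ []) *P liftP Q
  liftP-monomial*P a g []      = ≡.refl
  liftP-monomial*P a g (_ ∷ Q) = ≡.cong (_ ∷_) (liftP-monomial*P a g Q)

  liftP-*P : ∀ {n} (P Q : Poly n) → liftP (P *P Q) ≡ liftP P *P liftP Q
  liftP-*P []            Q = ≡.refl
  liftP-*P ((a , g) ∷ P) Q = begin
    liftP (((a , g) ∷ P) *P Q)
      ≡⟨ ≡.cong liftP (*P-∷ (a , g) P Q) ⟩
    liftP ((((a , g) ∷ []) *P Q) ++ (P *P Q))
      ≡⟨ List.map-++ _ (((a , g) ∷ []) *P Q) (P *P Q) ⟩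
    liftP (((a , g) ∷ []) *P Q) ++ liftP (P *P Q)
      ≡⟨ ≡.cong₂ _++_ (liftP-monomial*P a g Q) (liftP-*P P Q) ⟩
    (((a , 0 ∷ g) ∷ []) *P liftP Q) ++ (liftP P *P liftP Q)
      ≡⟨ *P-∷ (a , 0 ∷ g) (liftP P) (liftP Q) ⟨
    liftP ((a , g) ∷ P) *P liftP Q ∎

  liftP-^P : ∀ {n} (X : Poly n) k → liftP (X ^P k) ≡ liftP X ^P k
  liftP-^P X zero    = ≡.refl
  liftP-^P X (suc k) = ≡.trans (liftP-*P X (X ^P k)) (≡.cong (liftP X *P_) (liftP-^P X k))

  liftP-product : ∀ {n} (Xs : List.List (Poly n)) →
    List.foldr _*P_ 1P (List.map liftP Xs) ≡ liftP (List.foldr _*P_ 1P Xs)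
  liftP-product []       = ≡.refl
  liftP-product (X ∷ Xs) = ≡.trans (≡.cong (liftP X *P_) (liftP-product Xs)) (≡.sym (liftP-*P X _))

  shiftProduct : ∀ {n} → (Fin n → Carrier) → Vec ℕ n → Poly n
  shiftProduct {n} v f =
    List.foldr _*P_ 1P (List.map (λ j → (var j +P constP (- v j)) ^P lookup f j) (List.allFin n))

  shiftProduct-∷ : ∀ {n} (v : Fin (suc n) → Carrier) F f →
    shiftProduct v (F ∷ f) ≡ ((var zero +P constP (- v zero)) ^P F) *P liftP (shiftProduct (v ∘ suc) f)
  shiftProduct-∷ {n} v F f = ≡.cong (((var zero +P constP (- v zero)) ^P F) *P_) (begin
    List.foldr _*P_ 1P (List.map factor (List.tabulate suc))
      ≡⟨ ≡.cong (List.foldr _*P_ 1P) (List.map-tabulate suc factor) ⟩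
    List.foldr _*P_ 1P (List.tabulate (factor ∘ suc))
      ≡⟨ ≡.cong (List.foldr _*P_ 1P) (List.tabulate-cong λ j → liftP-^P (base′ j) (lookup f j)) ⟨
    List.foldr _*P_ 1P (List.tabulate (liftP ∘ factor′))
      ≡⟨ ≡.cong (List.foldr _*P_ 1P) (List.map-tabulate factor′ liftP) ⟨
    List.foldr _*P_ 1P (List.map liftP (List.tabulate factor′))
      ≡⟨ liftP-product (List.tabulate factor′) ⟩
    liftP (List.foldr _*P_ 1P (List.tabulate factor′))
      ≡⟨ ≡.cong (liftP ∘ List.foldr _*P_ 1P) (List.map-tabulate id factor′) ⟨
    liftP (shiftProduct (v ∘ suc) f) ∎)
    where
    factor : Fin (suc n) → Poly (suc n)
    factor j = (var j +P constP (- v j)) ^P lookup (F ∷ f) j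
    base′ : Fin n → Poly n
    base′ j = var j +P constP (- v (suc j))
    factor′ : Fin n → Poly n
    factor′ j = base′ j ^P lookup f j

module Polynomials {c ℓ} (K : Field c ℓ) where
  open Field K hiding (zero)
  open FieldOps K
  open Lifting K
  open import Algebra.Properties.Semiring.Mult semiring
  open import Algebra.Properties.CommutativeMonoid.Mult +-commutativeMonoid using (×-distrib-+)
  open import Algebra.Properties.Semiring.Sum semiring
    using (sum-syntax; ∑-distrib-+; *-distribˡ-sum; sum-cong-≋; sum-replicate-zero)
  open import Algebra.Properties.Ring ring using (-‿distribˡ-*; -1*x≈-x)
  open import Algebra.Properties.CommutativeSemigroup *-commutativeSemigroup using (x∙yz≈y∙xz)
  open import Algebra.Properties.CommutativeMonoid.Sum *-commutativeMonoid
    using () renaming (sum to ∏; sum-remove to ∏-remove; sum-cong-≗ to ∏-cong-≗)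
  open import Relation.Binary.Reasoning.Setoid setoid
  open import Algebra.Solver.Ring.NaturalCoefficients.Default commutativeSemiring
    using (solve; _:=_; _:+_; _:*_)
  open BinomialTerm semiring

  natMul≡× : ∀ k a → natMul k a ≡ k × a
  natMul≡× zero    a = ≡.refl
  natMul≡× (suc k) a = ≡.cong (a +_) (natMul≡× k a)

  ⟦_⟧ : ∀ {p} {P : Set p} → Dec P → Carrier
  ⟦ yes _ ⟧ = 1#
  ⟦ no _  ⟧ = 0#

  ×-zeroʳ : ∀ n → n × 0# ≈ 0#
  ×-zeroʳ zero    = refl
  ×-zeroʳ (suc n) = trans (+-identityˡ _) (×-zeroʳ n)

  ×-inner : ∀ m a b c → m × (a * (b * c)) ≈ a * (b * (m × c))
  ×-inner m a b c = trans (sym (×-comm-* m a _)) (*-congˡ (sym (×-comm-* m b c)))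

  atZero : ℕ → Carrier
  atZero zero    = 1#
  atZero (suc _) = 0#

  aboveZero : ℕ → Carrier
  aboveZero zero    = 0#
  aboveZero (suc _) = 1#

  raise : (ℕ → Carrier) → ℕ → Carrier
  raise φ k = k × φ (k ∸ 1)

  -- 𝒯 φ x stands for Σₖ φ(k)·Sₖ(x), the level parts Sₖ of a shifted polynomial weighted by φ.
  module LevelVanishing
    (charZero : CharZero)
    {a} {A : Set a} (𝒯 : (ℕ → Carrier) → A → Carrier)
    (𝒯-linear : ∀ φ ψ β x → 𝒯 (λ k → φ k + β * ψ k) x ≈ 𝒯 φ x + β * 𝒯 ψ x)
    (height : ℕ)
    (𝒯-bounded : ∀ φ → (∀ k → k ≤ height → φ k ≈ 0#) → ∀ x → 𝒯 φ x ≈ 0#)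
    (𝒯-raise : ∀ φ → (∀ x → 𝒯 φ x ≈ 0#) → ∀ x → 𝒯 (raise φ) x ≈ 0#)
    (𝒯-aboveZero : ∀ x → 𝒯 aboveZero x ≈ 0#)
    where

    VanishesUpTo : ℕ → (ℕ → Carrier) → Set ℓ
    VanishesUpTo m φ = ∀ k → k ≤ m → φ k ≈ 0#

    ψ : ℕ → ℕ → Carrier
    ψ zero    = aboveZero
    ψ (suc j) = raise (ψ j)

    𝒯-ψ : ∀ j x → 𝒯 (ψ j) x ≈ 0#
    𝒯-ψ zero    = 𝒯-aboveZero
    𝒯-ψ (suc j) = 𝒯-raise (ψ j) (𝒯-ψ j)

    ψ-vanishesUpTo : ∀ j → VanishesUpTo j (ψ j)
    ψ-vanishesUpTo zero    zero    _         = refl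
    ψ-vanishesUpTo (suc j) zero    _         = refl
    ψ-vanishesUpTo (suc j) (suc k) (s≤s k≤j) =
      trans (×-congʳ (suc k) (ψ-vanishesUpTo j k k≤j)) (×-zeroʳ (suc k))

    ψ-top : ∀ j → ψ j (suc j) ≈ (suc j !) × 1#
    ψ-top zero    = sym (+-identityʳ 1#)
    ψ-top (suc j) = begin
      suc (suc j) × ψ j (suc j)         ≈⟨ ×-congʳ (suc (suc j)) (ψ-top j) ⟩
      suc (suc j) × ((suc j !) × 1#)    ≈⟨ ×-assocˡ 1# (suc (suc j)) ((suc j) !) ⟩
      (suc (suc j) !) × 1#              ∎

    ψ-top≉0 : ∀ j → ¬ (ψ j (suc j) ≈ 0#)
    ψ-top≉0 j ψ≈0 = charZero (ℕ.pred ((suc j) !)) (begin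
      natMul (suc (ℕ.pred ((suc j) !))) 1# ≡⟨ natMul≡× (suc (ℕ.pred ((suc j) !))) 1# ⟩
      suc (ℕ.pred ((suc j) !)) × 1#        ≡⟨ ≡.cong (_× 1#) (ℕ.suc-pred ((suc j) !)) ⟩
      (suc j !) × 1#                       ≈⟨ ψ-top j ⟨
      ψ j (suc j)                          ≈⟨ ψ≈0 ⟩
      0#                                   ∎)
      where instance _ = (suc j) ℕ.!≢0

    𝒯-vanishes : ℕ → Set (a ⊔ c ⊔ ℓ)
    𝒯-vanishes m = ∀ φ → VanishesUpTo m φ → ∀ x → 𝒯 φ x ≈ 0#

    -- Subtracting the multiple of ψ m that kills φ (suc m) pushes the vanishing range up by one.
    𝒯-vanishes-step : ∀ m → 𝒯-vanishes (suc m) → 𝒯-vanishes m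
    𝒯-vanishes-step m next φ φ↓ x = begin
      𝒯 φ x                        ≈⟨ +-identityʳ _ ⟨
      𝒯 φ x + 0#                   ≈⟨ +-congˡ (trans (*-congˡ (𝒯-ψ m x)) (zeroʳ _)) ⟨
      𝒯 φ x + (- β) * 𝒯 (ψ m) x   ≈⟨ 𝒯-linear φ (ψ m) (- β) x ⟨
      𝒯 χ x                        ≈⟨ next χ χ↓ x ⟩
      0#                           ∎
      where
      top = ψ m (suc m)
      top⁻¹ = proj₁ (inverse top (ψ-top≉0 m))
      β = φ (suc m) * top⁻¹
      χ : ℕ → Carrier
      χ k = φ k + (- β) * ψ m k
      β*top≈φ : β * top ≈ φ (suc m)
      β*top≈φ = begin
        φ (suc m) * top⁻¹ * top    ≈⟨ *-assoc _ _ _ ⟩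
        φ (suc m) * (top⁻¹ * top)  ≈⟨ *-congˡ (trans (*-comm _ _) (proj₂ (inverse top (ψ-top≉0 m)))) ⟩
        φ (suc m) * 1#             ≈⟨ *-identityʳ _ ⟩
        φ (suc m)                  ∎
      χ↓ : VanishesUpTo (suc m) χ
      χ↓ k k≤1+m with ℕ.m≤n⇒m<n∨m≡n k≤1+m
      ... | inj₁ (s≤s k≤m) = begin
        φ k + (- β) * ψ m k  ≈⟨ +-cong (φ↓ k k≤m) (trans (*-congˡ (ψ-vanishesUpTo m k k≤m)) (zeroʳ _)) ⟩
        0# + 0#              ≈⟨ +-identityʳ 0# ⟩
        0#                   ∎
      ... | inj₂ ≡.refl = begin
        φ (suc m) + (- β) * top  ≈⟨ +-congˡ (-‿distribˡ-* β top) ⟨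
        φ (suc m) + - (β * top)  ≈⟨ +-congˡ (-‿cong β*top≈φ) ⟩
        φ (suc m) + - φ (suc m)  ≈⟨ -‿inverseʳ _ ⟩
        0#                       ∎

    𝒯-vanishes-down : ∀ m → 𝒯-vanishes m → 𝒯-vanishes 0
    𝒯-vanishes-down zero    = id
    𝒯-vanishes-down (suc m) = 𝒯-vanishes-down m ∘ 𝒯-vanishes-step m

    𝒯-vanishes-at-zero : ∀ φ → φ 0 ≈ 0# → ∀ x → 𝒯 φ x ≈ 0#
    𝒯-vanishes-at-zero φ φ0≈0 = 𝒯-vanishes-down height 𝒯-bounded φ λ { zero _ → φ0≈0 }

  kernelFactor : ∀ {n} → (Fin n → Carrier) → Vec ℕ n → Vec ℕ n → Fin n → Carrier
  kernelFactor w f e j = binomialTerm (w j) (lookup f j) (lookup e j)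

  shiftKernel : ∀ {n} → (Fin n → Carrier) → Vec ℕ n → Vec ℕ n → Carrier
  shiftKernel w f e = ∏ (kernelFactor w f e)

  kernelAway : ∀ {n} → (Fin n → Carrier) → Fin n → Vec ℕ n → Vec ℕ n → Carrier
  kernelAway {suc n} w i f e = ∏ (removeAt (kernelFactor w f e) i)

  kernelAway-cong : ∀ {n} (w : Fin n → Carrier) i {f f′ e e′ : Vec ℕ n} →
    AgreeOff i f f′ → AgreeOff i e e′ → kernelAway w i f e ≡ kernelAway w i f′ e′
  kernelAway-cong {suc n} w i f≈f′ e≈e′ = ∏-cong-≗ λ j →
    ≡.cong₂ (binomialTerm (w (punchIn i j))) (f≈f′ _ (punchInᵢ≢i i j)) (e≈e′ _ (punchInᵢ≢i i j))

  shiftKernel-split : ∀ {n} (w : Fin n → Carrier) i (f e : Vec ℕ n) →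
    shiftKernel w f e ≈ kernelFactor w f e i * kernelAway w i f e
  shiftKernel-split {suc n} w i f e = ∏-remove {i = i} (kernelFactor w f e)

  shiftKernel-agreeOff : ∀ {n} (w : Fin n → Carrier) i (f f′ e e′ : Vec ℕ n) →
    AgreeOff i f f′ → AgreeOff i e e′ → shiftKernel w f e ≈ kernelFactor w f e i * kernelAway w i f′ e′
  shiftKernel-agreeOff w i f f′ e e′ f≈f′ e≈e′ =
    trans (shiftKernel-split w i f e) (*-congˡ (reflexive (kernelAway-cong w i f≈f′ e≈e′)))

  shiftKernel-diag : ∀ {n} (w : Fin n → Carrier) e → shiftKernel w e e ≈ 1#
  shiftKernel-diag w []      = refl
  shiftKernel-diag w (x ∷ e) =
    trans (*-cong (binomialTerm-diag (w zero) x) (shiftKernel-diag (w ∘ suc) e)) (*-identityˡ 1#)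

  shiftKernel-offDiag : ∀ {n} (w : Fin n → Carrier) (f e : Vec ℕ n) →
    gap f e ≡ 0 → f ≢ e → shiftKernel w f e ≈ 0#
  shiftKernel-offDiag w []      []      _      []≢[] = ⊥-elim ([]≢[] ≡.refl)
  shiftKernel-offDiag w (F ∷ f) (x ∷ e) gap≡0 f≢e
    with ℕ.m≤n⇒m<n∨m≡n (ℕ.m∸n≡0⇒m≤n {F} {x} (ℕ.m+n≡0⇒m≡0 (F ∸ x) gap≡0))
  ... | inj₁ F<x    = trans (*-congʳ (binomialTerm-over (w zero) F<x)) (zeroˡ _)
  ... | inj₂ ≡.refl = trans (*-congˡ (shiftKernel-offDiag (w ∘ suc) f e gap′≡0 (f≢e ∘ ≡.cong (F ∷_)))) (zeroʳ _)
    where gap′≡0 = ℕ.m+n≡0⇒n≡0 (F ∸ F) gap≡0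

  shiftKernel-degree : ∀ {n} (w : Fin n → Carrier) (f e : Vec ℕ n) →
    Vec.sum e ℕ.+ gap f e ≡ Vec.sum f ⊎ shiftKernel w f e ≈ 0#
  shiftKernel-degree w []      []      = inj₁ ≡.refl
  shiftKernel-degree w (F ∷ f) (x ∷ e) with x ℕ.≤? F | shiftKernel-degree (w ∘ suc) f e
  ... | no x≰F | _          = inj₂ (trans (*-congʳ (binomialTerm-over (w zero) (ℕ.≰⇒> x≰F))) (zeroˡ _))
  ... | yes _  | inj₂ K≈0   = inj₂ (trans (*-congˡ K≈0) (zeroʳ _))
  ... | yes x≤F | inj₁ sum≡ = inj₁ (≡.trans
    (interchange x (Vec.sum e) (F ∸ x) (gap f e))
    (≡.cong₂ ℕ._+_ (ℕ.m+[n∸m]≡n x≤F) sum≡))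

  shiftKernel-lower : ∀ {n} (w : Fin n → Carrier) (f e : Vec ℕ n) j →
    w j * (suc (lookup e j) × shiftKernel w f (e [ j ]%= suc))
      ≈ (lookup f j ∸ lookup e j) × shiftKernel w f e
  shiftKernel-lower w f e j = begin
    w j * (s × shiftKernel w f e′)
      ≈⟨ *-congˡ (×-congʳ s (shiftKernel-agreeOff w j f f e′ e (agreeOff-refl j f) (agreeOff-[]%= j suc e))) ⟩
    w j * (s × (kernelFactor w f e′ j * A))
      ≡⟨ ≡.cong (λ x → w j * (s × (binomialTerm (w j) (lookup f j) x * A))) (lookup∘updateAt j e) ⟩
    w j * (s × (binomialTerm (w j) (lookup f j) s * A))
      ≈⟨ trans (*-assoc _ _ A) (*-congˡ (×-assoc-* s _ A)) ⟨
    (w j * (s × binomialTerm (w j) (lookup f j) s)) * A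
      ≈⟨ *-congʳ (binomialTerm-lower (w j) (lookup f j) (lookup e j)) ⟩
    (d × kernelFactor w f e j) * A
      ≈⟨ trans (×-assoc-* d _ A) (×-congʳ d (sym (shiftKernel-split w j f e))) ⟩
    d × shiftKernel w f e ∎
    where
    s = suc (lookup e j)
    d = lookup f j ∸ lookup e j
    e′ = e [ j ]%= suc
    A = kernelAway w j f e

  shiftKernel-raise : ∀ {n} (w : Fin n → Carrier) i (f e : Vec ℕ n) {k} → lookup f i ≡ suc k →
    suc k × shiftKernel w (f [ i ]≔ k) e ≈ suc (lookup e i) × shiftKernel w f (e [ i ]%= suc)
  shiftKernel-raise w i f e {k} fᵢ≡1+k = begin
    suc k × shiftKernel w f′ e
      ≈⟨ ×-congʳ (suc k) (shiftKernel-agreeOff w i f′ f e e (agreeOff-[]%= i (λ _ → k) f) (agreeOff-refl i e)) ⟩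
    suc k × (kernelFactor w f′ e i * A)
      ≡⟨ ≡.cong (λ F → suc k × (binomialTerm (w i) F (lookup e i) * A)) (lookup∘updateAt i f) ⟩
    suc k × (binomialTerm (w i) k (lookup e i) * A)
      ≈⟨ ×-assoc-* (suc k) _ A ⟨
    (suc k × binomialTerm (w i) k (lookup e i)) * A
      ≈⟨ *-congʳ (binomialTerm-raise (w i) k (lookup e i)) ⟩
    (s × binomialTerm (w i) (suc k) s) * A
      ≈⟨ ×-assoc-* s _ A ⟩
    s × (binomialTerm (w i) (suc k) s * A)
      ≡⟨ ≡.cong₂ (λ F x → s × (binomialTerm (w i) F x * A)) fᵢ≡1+k (lookup∘updateAt i e) ⟨
    s × (kernelFactor w f e′ i * A)
      ≈⟨ ×-congʳ s (shiftKernel-agreeOff w i f f e′ e (agreeOff-refl i f) (agreeOff-[]%= i suc e)) ⟨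
    s × shiftKernel w f e′ ∎
    where
    s = suc (lookup e i)
    f′ = f [ i ]≔ k
    e′ = e [ i ]%= suc
    A = kernelAway w i f e

  shiftKernel-[]%=suc : ∀ {n} (w : Fin n → Carrier) i (f e : Vec ℕ n) → lookup f i ≡ 0 →
    shiftKernel w f (e [ i ]%= suc) ≈ 0#
  shiftKernel-[]%=suc w i f e fᵢ≡0 = begin
    shiftKernel w f e′
      ≈⟨ shiftKernel-split w i f e′ ⟩
    kernelFactor w f e′ i * kernelAway w i f e′
      ≡⟨ ≡.cong₂ (λ F x → binomialTerm (w i) F x * kernelAway w i f e′) fᵢ≡0 (lookup∘updateAt i e) ⟩
    binomialTerm (w i) 0 (suc (lookup e i)) * kernelAway w i f e′
      ≈⟨ trans (*-congʳ (binomialTerm-over (w i) (s≤s (ℕ.z≤n {lookup e i})))) (zeroˡ _) ⟩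
    0# ∎
    where e′ = e [ i ]%= suc

  -- The coefficient of x^e in p(x + w), with the part coming from each monomial x^f of p
  -- weighted by φ of its level gap f e (= |f| − |e| unless the kernel vanishes).
  shiftCoeff : ∀ {n} → (Fin n → Carrier) → (ℕ → Carrier) → Poly n → Vec ℕ n → Carrier
  shiftCoeff w φ []            e = 0#
  shiftCoeff w φ ((a , f) ∷ p) e = a * (φ (gap f e) * shiftKernel w f e) + shiftCoeff w φ p e

  shiftCoeff-cong : ∀ {n} (w : Fin n → Carrier) {φ ψ : ℕ → Carrier} →
    (∀ k → φ k ≈ ψ k) → ∀ p e → shiftCoeff w φ p e ≈ shiftCoeff w ψ p e
  shiftCoeff-cong w φ≈ψ []            e = refl
  shiftCoeff-cong w φ≈ψ ((a , f) ∷ p) e =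
    +-cong (*-congˡ (*-congʳ (φ≈ψ (gap f e)))) (shiftCoeff-cong w φ≈ψ p e)

  shiftCoeff-linear : ∀ {n} (w : Fin n → Carrier) φ ψ β p e →
    shiftCoeff w (λ k → φ k + β * ψ k) p e ≈ shiftCoeff w φ p e + β * shiftCoeff w ψ p e
  shiftCoeff-linear w φ ψ β []            e = sym (trans (+-congˡ (zeroʳ β)) (+-identityʳ 0#))
  shiftCoeff-linear w φ ψ β ((a , f) ∷ p) e = begin
    a * ((φ g + β * ψ g) * κ) + shiftCoeff w _ p e
      ≈⟨ +-congˡ (shiftCoeff-linear w φ ψ β p e) ⟩
    a * ((φ g + β * ψ g) * κ) + (shiftCoeff w φ p e + β * shiftCoeff w ψ p e)
      ≈⟨ solve 7 (λ a x b y k S T → a :* ((x :+ b :* y) :* k) :+ (S :+ b :* T)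
                                   := (a :* (x :* k) :+ S) :+ b :* (a :* (y :* k) :+ T))
                 refl a (φ g) β (ψ g) κ (shiftCoeff w φ p e) (shiftCoeff w ψ p e) ⟩
    (a * (φ g * κ) + shiftCoeff w φ p e) + β * (a * (ψ g * κ) + shiftCoeff w ψ p e) ∎
    where
    g = gap f e
    κ = shiftKernel w f e

  shiftCoeff-+P : ∀ {n} (w : Fin n → Carrier) φ (p q : Poly n) e →
    shiftCoeff w φ (p +P q) e ≈ shiftCoeff w φ p e + shiftCoeff w φ q e
  shiftCoeff-+P w φ []            q e = sym (+-identityˡ _)
  shiftCoeff-+P w φ ((a , f) ∷ p) q e = trans (+-congˡ (shiftCoeff-+P w φ p q e)) (sym (+-assoc _ _ _))

  degreeSum : ∀ {n} → Poly n → ℕ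
  degreeSum p = ℕ.sum (List.map (degree ∘ proj₂) p)

  shiftCoeff-bounded : ∀ {n} (w : Fin n → Carrier) p φ →
    (∀ k → k ≤ degreeSum p → φ k ≈ 0#) → ∀ e → shiftCoeff w φ p e ≈ 0#
  shiftCoeff-bounded w []            φ φ↓ e = refl
  shiftCoeff-bounded w ((a , f) ∷ p) φ φ↓ e = begin
    a * (φ (gap f e) * shiftKernel w f e) + shiftCoeff w φ p e
      ≈⟨ +-cong (*-congˡ (*-congʳ (φ↓ _ (ℕ.≤-trans (gap≤sum f e) (ℕ.m≤m+n _ _)))))
                (shiftCoeff-bounded w p φ (λ k k≤ → φ↓ k (ℕ.≤-trans k≤ (ℕ.m≤n+m _ _))) e) ⟩
    a * (0# * shiftKernel w f e) + 0#
      ≈⟨ trans (+-identityʳ _) (trans (*-congˡ (zeroˡ _)) (zeroʳ a)) ⟩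
    0# ∎

  coeff-∷-≡ : ∀ {n} a (f : Vec ℕ n) p → coeff ((a , f) ∷ p) f ≈ a + coeff p f
  coeff-∷-≡ a f p with ≡-dec ℕ._≟_ f f
  ... | yes _   = refl
  ... | no f≢f = ⊥-elim (f≢f ≡.refl)

  coeff-∷-≢ : ∀ {n} a (f e : Vec ℕ n) p → f ≢ e → coeff ((a , f) ∷ p) e ≈ coeff p e
  coeff-∷-≢ a f e p f≢e with ≡-dec ℕ._≟_ f e
  ... | yes f≡e = ⊥-elim (f≢e f≡e)
  ... | no _    = refl

  coeff-+P : ∀ {n} (p q : Poly n) e → coeff (p +P q) e ≈ coeff p e + coeff q e
  coeff-+P []            q e = sym (+-identityˡ _)
  coeff-+P ((a , f) ∷ p) q e with ≡-dec ℕ._≟_ f e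
  ... | yes _ = trans (+-congˡ (coeff-+P p q e)) (sym (+-assoc _ _ _))
  ... | no _  = coeff-+P p q e

  coeff-scaleP : ∀ {n} a (p : Poly n) e → coeff (scaleP a p) e ≈ a * coeff p e
  coeff-scaleP a []            e = sym (zeroʳ a)
  coeff-scaleP a ((b , f) ∷ p) e with ≡-dec ℕ._≟_ f e
  ... | yes _ = trans (+-congˡ (coeff-scaleP a p e)) (sym (distribˡ a b _))
  ... | no _  = coeff-scaleP a p e

  coeff-negP : ∀ {n} (p : Poly n) e → coeff (negP p) e ≈ - coeff p e
  coeff-negP p e = trans (coeff-scaleP (- 1#) p e) (-1*x≈-x _)

  coeff≈shiftCoeff-atZero : ∀ {n} (w : Fin n → Carrier) p e → coeff p e ≈ shiftCoeff w atZero p e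
  coeff≈shiftCoeff-atZero w []            e = refl
  coeff≈shiftCoeff-atZero w ((a , f) ∷ p) e with ≡-dec ℕ._≟_ f e
  ... | yes ≡.refl = +-cong (sym diag) (coeff≈shiftCoeff-atZero w p e)
    where
    diag : a * (atZero (gap f f) * shiftKernel w f f) ≈ a
    diag = begin
      a * (atZero (gap f f) * shiftKernel w f f)
        ≡⟨ ≡.cong (λ g → a * (atZero g * shiftKernel w f f)) (gap-self f) ⟩
      a * (1# * shiftKernel w f f)               ≈⟨ *-congˡ (trans (*-identityˡ _) (shiftKernel-diag w f)) ⟩
      a * 1#                                     ≈⟨ *-identityʳ a ⟩
      a                                          ∎
  ... | no f≢e = trans (coeff≈shiftCoeff-atZero w p e) (sym (trans (+-congʳ offDiag) (+-identityˡ _)))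
    where
    offDiag : a * (atZero (gap f e) * shiftKernel w f e) ≈ 0#
    offDiag with gap f e in gap≡
    ... | zero  = trans (*-congˡ (trans (*-identityˡ _) (shiftKernel-offDiag w f e gap≡ f≢e))) (zeroʳ a)
    ... | suc _ = trans (*-congˡ (zeroˡ _)) (zeroʳ a)

  coeff-monomial*P : ∀ {n} a (g : Vec ℕ n) Q {h′ h} → Vec.zipWith ℕ._+_ g h′ ≡ h →
    coeff (((a , g) ∷ []) *P Q) h ≈ a * coeff Q h′
  coeff-monomial*P a g []            ≡.refl = sym (zeroʳ a)
  coeff-monomial*P a g ((b , f) ∷ Q) {h′} ≡.refl
    with ≡-dec ℕ._≟_ (Vec.zipWith ℕ._+_ g f) (Vec.zipWith ℕ._+_ g h′) | ≡-dec ℕ._≟_ f h′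
  ... | yes _       | yes _      = trans (+-congˡ (coeff-monomial*P a g Q ≡.refl)) (sym (distribˡ a b _))
  ... | yes g+f≡g+h | no f≢h     = ⊥-elim (f≢h (zipWith-+-cancelˡ g g+f≡g+h))
  ... | no g+f≢g+h  | yes ≡.refl = ⊥-elim (g+f≢g+h ≡.refl)
  ... | no _        | no _       = coeff-monomial*P a g Q ≡.refl

  coeff-monomial*P-below : ∀ {n} a g₀ (g : Vec ℕ n) Q {x} e → x < g₀ →
    coeff (((a , g₀ ∷ g) ∷ []) *P Q) (x ∷ e) ≈ 0#
  coeff-monomial*P-below a g₀ g []                  e x<g₀ = refl
  coeff-monomial*P-below a g₀ g ((b , f₀ ∷ f) ∷ Q) {x} e x<g₀ =
    trans (coeff-∷-≢ (a * b) (g₀ ℕ.+ f₀ ∷ Vec.zipWith ℕ._+_ g f) (x ∷ e) (((a , g₀ ∷ g) ∷ []) *P Q) g₀+f₀≢x)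
          (coeff-monomial*P-below a g₀ g Q e x<g₀)
    where
    g₀+f₀≢x : g₀ ℕ.+ f₀ ∷ Vec.zipWith ℕ._+_ g f ≢ x ∷ e
    g₀+f₀≢x eq = ℕ.<⇒≱ x<g₀ (ℕ.m+n≤o⇒m≤o g₀ (ℕ.≤-reflexive (≡.cong Vec.head eq)))

  coeff-liftP-zero : ∀ {n} (Y : Poly n) e → coeff (liftP Y) (0 ∷ e) ≈ coeff Y e
  coeff-liftP-zero []            e = refl
  coeff-liftP-zero ((b , f) ∷ Y) e with ≡-dec ℕ._≟_ f e
  ... | yes _ = +-congˡ (coeff-liftP-zero Y e)
  ... | no _  = coeff-liftP-zero Y e

  coeff-liftP-suc : ∀ {n} (Y : Poly n) x e → coeff (liftP Y) (suc x ∷ e) ≈ 0#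
  coeff-liftP-suc []      x e = refl
  coeff-liftP-suc (_ ∷ Y) x e = coeff-liftP-suc Y x e

  InX₀ : ∀ {n} → Poly (suc n) → Set c
  InX₀ {n} = All (λ t → Vec.tail (proj₂ t) ≡ Vec.replicate n 0)

  InX₀-*P : ∀ {n} (P Q : Poly (suc n)) → InX₀ P → InX₀ Q → InX₀ (P *P Q)
  InX₀-*P []      Q []         Q₀ = []
  InX₀-*P (t ∷ P) Q (t₀ ∷ P₀) Q₀ =
    ≡.subst InX₀ (≡.sym (*P-∷ t P Q)) (All.++⁺ (monomial t t₀ Q Q₀) (InX₀-*P P Q P₀ Q₀))
    where
    monomial : ∀ t → Vec.tail (proj₂ t) ≡ Vec.replicate _ 0 → ∀ Q → InX₀ Q → InX₀ ((t ∷ []) *P Q)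
    monomial t         t₀ []               []          = []
    monomial (a , g₀ ∷ g) t₀ ((b , f₀ ∷ f) ∷ Q) (f≡0 ∷ Q₀) =
      ≡.trans (≡.cong₂ (Vec.zipWith ℕ._+_) t₀ f≡0) (zipWith-identityˡ ℕ.+-identityˡ _)
        ∷ monomial (a , g₀ ∷ g) t₀ Q Q₀

  InX₀-binomialPower : ∀ {n} c F → InX₀ ((var {suc n} zero +P constP c) ^P F)
  InX₀-binomialPower c zero    = ≡.refl ∷ []
  InX₀-binomialPower c (suc F) = InX₀-*P _ _ (≡.refl ∷ ≡.refl ∷ []) (InX₀-binomialPower c F)

  coeff-x₀-monomial*P-liftP : ∀ {n} b k (Y : Poly n) x e →
    coeff (((b , k ∷ Vec.replicate n 0) ∷ []) *P liftP Y) (x ∷ e) ≈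
    coeff ((b , k ∷ Vec.replicate n 0) ∷ []) (x ∷ Vec.replicate n 0) * coeff Y e
  coeff-x₀-monomial*P-liftP {n} b k Y x e with ℕ.<-cmp x k
  ... | tri< x<k k≢x _ = begin
    coeff (((b , k ∷ zeros) ∷ []) *P liftP Y) (x ∷ e) ≈⟨ coeff-monomial*P-below b k zeros (liftP Y) e x<k ⟩
    0#                                                 ≈⟨ zeroˡ _ ⟨
    0# * coeff Y e
      ≈⟨ *-congʳ (coeff-∷-≢ b (k ∷ zeros) (x ∷ zeros) [] (k≢x ∘ ≡.sym ∘ ≡.cong Vec.head)) ⟨
    coeff ((b , k ∷ zeros) ∷ []) (x ∷ zeros) * coeff Y e ∎
    where zeros = Vec.replicate n 0
  ... | tri≈ _ ≡.refl _ = begin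
    coeff (((b , k ∷ zeros) ∷ []) *P liftP Y) (k ∷ e)
      ≈⟨ coeff-monomial*P b _ (liftP Y) (≡.cong₂ _∷_ (ℕ.+-identityʳ k) (zipWith-identityˡ ℕ.+-identityˡ e)) ⟩
    b * coeff (liftP Y) (0 ∷ e)
      ≈⟨ *-cong (sym (+-identityʳ b)) (coeff-liftP-zero Y e) ⟩
    (b + 0#) * coeff Y e                               ≈⟨ *-congʳ (coeff-∷-≡ b (k ∷ zeros) []) ⟨
    coeff ((b , k ∷ zeros) ∷ []) (k ∷ zeros) * coeff Y e ∎
    where zeros = Vec.replicate n 0
  ... | tri> _ x≢k k<x with ℕ.m≤n⇒∃[o]m+o≡n k<x
  ...   | d , ≡.refl = begin
    coeff (((b , k ∷ zeros) ∷ []) *P liftP Y) (suc k ℕ.+ d ∷ e)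
      ≈⟨ coeff-monomial*P b _ (liftP Y) (≡.cong₂ _∷_ (ℕ.+-suc k d) (zipWith-identityˡ ℕ.+-identityˡ e)) ⟩
    b * coeff (liftP Y) (suc d ∷ e)                    ≈⟨ trans (*-congˡ (coeff-liftP-suc Y d e)) (zeroʳ b) ⟩
    0#                                                 ≈⟨ zeroˡ _ ⟨
    0# * coeff Y e
      ≈⟨ *-congʳ (coeff-∷-≢ b (k ∷ zeros) (suc k ℕ.+ d ∷ zeros) [] (x≢k ∘ ≡.sym ∘ ≡.cong Vec.head)) ⟨
    coeff ((b , k ∷ zeros) ∷ []) (suc k ℕ.+ d ∷ zeros) * coeff Y e ∎
    where zeros = Vec.replicate n 0

  coeff-*P-liftP : ∀ {n} (X : Poly (suc n)) → InX₀ X → ∀ (Y : Poly n) x e →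
    coeff (X *P liftP Y) (x ∷ e) ≈ coeff X (x ∷ Vec.replicate n 0) * coeff Y e
  coeff-*P-liftP []                   []          Y x e = sym (zeroˡ _)
  coeff-*P-liftP {n} ((b , k ∷ _) ∷ X) (≡.refl ∷ X₀) Y x e = begin
    coeff (((b , k ∷ zeros) ∷ X) *P liftP Y) (x ∷ e)
      ≡⟨ ≡.cong (λ P → coeff P (x ∷ e)) (*P-∷ (b , k ∷ zeros) X (liftP Y)) ⟩
    coeff ((((b , k ∷ zeros) ∷ []) *P liftP Y) +P (X *P liftP Y)) (x ∷ e)
      ≈⟨ coeff-+P (((b , k ∷ zeros) ∷ []) *P liftP Y) (X *P liftP Y) (x ∷ e) ⟩
    coeff (((b , k ∷ zeros) ∷ []) *P liftP Y) (x ∷ e) + coeff (X *P liftP Y) (x ∷ e)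
      ≈⟨ +-cong (coeff-x₀-monomial*P-liftP b k Y x e) (coeff-*P-liftP X X₀ Y x e) ⟩
    coeff ((b , k ∷ zeros) ∷ []) (x ∷ zeros) * coeff Y e + coeff X (x ∷ zeros) * coeff Y e
      ≈⟨ distribʳ _ _ _ ⟨
    (coeff ((b , k ∷ zeros) ∷ []) (x ∷ zeros) + coeff X (x ∷ zeros)) * coeff Y e
      ≈⟨ *-congʳ (coeff-+P ((b , k ∷ zeros) ∷ []) X (x ∷ zeros)) ⟨
    coeff ((b , k ∷ zeros) ∷ X) (x ∷ zeros) * coeff Y e ∎
    where zeros = Vec.replicate n 0

  coeff-binomialPower : ∀ {n} y F x →
    coeff ((var {suc n} zero +P constP y) ^P F) (x ∷ Vec.replicate n 0) ≈ binomialTerm y F x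
  coeff-binomialPower {n} y zero zero    =
    trans (coeff-∷-≡ 1# (0 ∷ Vec.replicate n 0) []) (trans (+-identityʳ 1#) (sym (binomialTerm-diag y 0)))
  coeff-binomialPower {n} y zero (suc x) =
    trans (coeff-∷-≢ 1# (0 ∷ Vec.replicate n 0) (suc x ∷ Vec.replicate n 0) [] (λ ()))
          (sym (binomialTerm-over y (s≤s (ℕ.z≤n {x}))))
  coeff-binomialPower {n} y (suc F) x = begin
    coeff (((1# , 1 ∷ zeros) ∷ (y , 0 ∷ zeros) ∷ []) *P R) (x ∷ zeros)
      ≡⟨ ≡.cong (λ P → coeff P (x ∷ zeros)) (*P-∷ (1# , 1 ∷ zeros) ((y , 0 ∷ zeros) ∷ []) R) ⟩
    coeff ((((1# , 1 ∷ zeros) ∷ []) *P R) +P (((y , 0 ∷ zeros) ∷ []) *P R)) (x ∷ zeros)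
      ≈⟨ coeff-+P (((1# , 1 ∷ zeros) ∷ []) *P R) _ (x ∷ zeros) ⟩
    coeff (((1# , 1 ∷ zeros) ∷ []) *P R) (x ∷ zeros) + coeff (((y , 0 ∷ zeros) ∷ []) *P R) (x ∷ zeros)
      ≈⟨ +-congˡ (coeff-monomial*P y (0 ∷ zeros) R (≡.cong (x ∷_) zeros+zeros)) ⟩
    coeff (((1# , 1 ∷ zeros) ∷ []) *P R) (x ∷ zeros) + y * coeff R (x ∷ zeros)
      ≈⟨ +-congˡ (*-congˡ (coeff-binomialPower y F x)) ⟩
    coeff (((1# , 1 ∷ zeros) ∷ []) *P R) (x ∷ zeros) + y * binomialTerm y F x
      ≈⟨ multiplyByX₀ x ⟩
    binomialTerm y (suc F) x ∎
    where
    zeros = Vec.replicate n 0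
    R = (var zero +P constP y) ^P F
    zeros+zeros : Vec.zipWith ℕ._+_ zeros zeros ≡ zeros
    zeros+zeros = zipWith-identityˡ ℕ.+-identityˡ zeros
    multiplyByX₀ : ∀ x →
      coeff (((1# , 1 ∷ zeros) ∷ []) *P R) (x ∷ zeros) + y * binomialTerm y F x ≈ binomialTerm y (suc F) x
    multiplyByX₀ zero    = begin
      coeff (((1# , 1 ∷ zeros) ∷ []) *P R) (0 ∷ zeros) + y * binomialTerm y F 0
        ≈⟨ +-congʳ (coeff-monomial*P-below 1# 1 zeros R zeros (s≤s ℕ.z≤n)) ⟩
      0# + y * binomialTerm y F 0  ≈⟨ +-identityˡ _ ⟩
      y * binomialTerm y F 0       ≈⟨ binomialTerm-suc-zero y F ⟨
      binomialTerm y (suc F) 0     ∎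
    multiplyByX₀ (suc x) = begin
      coeff (((1# , 1 ∷ zeros) ∷ []) *P R) (suc x ∷ zeros) + y * binomialTerm y F (suc x)
        ≈⟨ +-congʳ (coeff-monomial*P 1# (1 ∷ zeros) R (≡.cong (suc x ∷_) zeros+zeros)) ⟩
      1# * coeff R (x ∷ zeros) + y * binomialTerm y F (suc x)
        ≈⟨ +-congʳ (trans (*-identityˡ _) (coeff-binomialPower y F x)) ⟩
      binomialTerm y F x + y * binomialTerm y F (suc x)
        ≈⟨ binomialTerm-suc-suc y F x ⟨
      binomialTerm y (suc F) (suc x) ∎

  coeff-shiftProduct : ∀ {n} (v : Fin n → Carrier) f e →
    coeff (shiftProduct v f) e ≈ shiftKernel (λ j → - v j) f e
  coeff-shiftProduct v []      []      = +-identityʳ 1#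
  coeff-shiftProduct v (F ∷ f) (x ∷ e) = begin
    coeff (shiftProduct v (F ∷ f)) (x ∷ e)
      ≡⟨ ≡.cong (λ P → coeff P (x ∷ e)) (shiftProduct-∷ v F f) ⟩
    coeff (((var zero +P constP (- v zero)) ^P F) *P liftP (shiftProduct (v ∘ suc) f)) (x ∷ e)
      ≈⟨ coeff-*P-liftP _ (InX₀-binomialPower (- v zero) F) (shiftProduct (v ∘ suc) f) x e ⟩
    coeff ((var zero +P constP (- v zero)) ^P F) (x ∷ _) * coeff (shiftProduct (v ∘ suc) f) e
      ≈⟨ *-cong (coeff-binomialPower (- v zero) F x) (coeff-shiftProduct (v ∘ suc) f e) ⟩
    binomialTerm (- v zero) F x * shiftKernel (λ j → - v (suc j)) f e ∎

  coeff-shiftP : ∀ {n} (v : Fin n → Carrier) p e →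
    coeff (shiftP v p) e ≈ shiftCoeff (λ j → - v j) (λ _ → 1#) p e
  coeff-shiftP v []            e = refl
  coeff-shiftP v ((a , f) ∷ p) e = begin
    coeff (scaleP a (shiftProduct v f) +P shiftP v p) e
      ≈⟨ coeff-+P (scaleP a (shiftProduct v f)) (shiftP v p) e ⟩
    coeff (scaleP a (shiftProduct v f)) e + coeff (shiftP v p) e
      ≈⟨ +-cong (coeff-scaleP a (shiftProduct v f) e) (coeff-shiftP v p e) ⟩
    a * coeff (shiftProduct v f) e + shiftCoeff (λ j → - v j) (λ _ → 1#) p e
      ≈⟨ +-congʳ (*-congˡ (trans (coeff-shiftProduct v f e) (sym (*-identityˡ _)))) ⟩
    a * (1# * shiftKernel (λ j → - v j) f e) + shiftCoeff (λ j → - v j) (λ _ → 1#) p e ∎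

  coeff-Δ : ∀ {n} (M : Fin n → Fin n → Carrier) i p e →
    coeff (Δ M i p) e ≈ shiftCoeff (λ j → - M i j) aboveZero p e
  coeff-Δ M i p e = begin
    coeff (shiftP (M i) p +P negP p) e                  ≈⟨ coeff-+P (shiftP (M i) p) (negP p) e ⟩
    coeff (shiftP (M i) p) e + coeff (negP p) e         ≈⟨ +-cong (coeff-shiftP (M i) p e) (coeff-negP p e) ⟩
    shiftCoeff w (λ _ → 1#) p e + - coeff p e
      ≈⟨ +-cong (shiftCoeff-cong w one-split p e) (-‿cong (coeff≈shiftCoeff-atZero w p e)) ⟩
    shiftCoeff w (λ k → aboveZero k + 1# * atZero k) p e + - shiftCoeff w atZero p e
      ≈⟨ +-congʳ (shiftCoeff-linear w aboveZero atZero 1# p e) ⟩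
    (shiftCoeff w aboveZero p e + 1# * shiftCoeff w atZero p e) + - shiftCoeff w atZero p e
      ≈⟨ +-congʳ (+-congˡ (*-identityˡ _)) ⟩
    (shiftCoeff w aboveZero p e + shiftCoeff w atZero p e) + - shiftCoeff w atZero p e
      ≈⟨ +-assoc _ _ _ ⟩
    shiftCoeff w aboveZero p e + (shiftCoeff w atZero p e + - shiftCoeff w atZero p e)
      ≈⟨ trans (+-congˡ (-‿inverseʳ _)) (+-identityʳ _) ⟩
    shiftCoeff w aboveZero p e                          ∎
    where
    w = λ j → - M i j
    one-split : ∀ k → 1# ≈ aboveZero k + 1# * atZero k
    one-split zero    = sym (trans (+-identityˡ _) (*-identityˡ 1#))
    one-split (suc k) = sym (trans (+-congˡ (zeroʳ 1#)) (+-identityʳ 1#))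

  homog-accept : ∀ {n} d a (f : Vec ℕ n) p → degree f ≡ d → homog d ((a , f) ∷ p) ≡ (a , f) ∷ homog d p
  homog-accept d a f p deg≡d =
    List.filter-accept (T? ∘ λ t → ⌊ degree (proj₂ t) ℕ.≟ d ⌋) {x = a , f} {xs = p} (fromWitness deg≡d)

  homog-reject : ∀ {n} d a (f : Vec ℕ n) p → degree f ≢ d → homog d ((a , f) ∷ p) ≡ homog d p
  homog-reject d a f p deg≢d =
    List.filter-reject (T? ∘ λ t → ⌊ degree (proj₂ t) ℕ.≟ d ⌋) {x = a , f} {xs = p} (deg≢d ∘ toWitness)

  shiftCoeff-homog : ∀ {n} (w : Fin n → Carrier) φ d p e →
    shiftCoeff w φ (homog d p) e ≈ shiftCoeff w (λ k → ⟦ degree e ℕ.+ k ℕ.≟ d ⟧ * φ k) p e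
  shiftCoeff-homog w φ d []            e = refl
  shiftCoeff-homog w φ d ((a , f) ∷ p) e = byDegree (degree f ℕ.≟ d)
    where
    g = gap f e
    κ = shiftKernel w f e
    χ = λ k → ⟦ degree e ℕ.+ k ℕ.≟ d ⟧
    byDegree : Dec (degree f ≡ d) →
      shiftCoeff w φ (homog d ((a , f) ∷ p)) e ≈ a * ((χ g * φ g) * κ) + shiftCoeff w (λ k → χ k * φ k) p e
    byDegree (yes deg≡d) = begin
      shiftCoeff w φ (homog d ((a , f) ∷ p)) e
        ≡⟨ ≡.cong (λ q → shiftCoeff w φ q e) (homog-accept d a f p deg≡d) ⟩
      a * (φ g * κ) + shiftCoeff w φ (homog d p) e ≈⟨ +-cong (*-congˡ kept) (shiftCoeff-homog w φ d p e) ⟩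
      a * ((χ g * φ g) * κ) + shiftCoeff w (λ k → χ k * φ k) p e ∎
      where
      kept : φ g * κ ≈ (χ g * φ g) * κ
      kept with shiftKernel-degree w f e | degree e ℕ.+ g ℕ.≟ d
      ... | _          | yes _ = *-congʳ (sym (*-identityˡ _))
      ... | inj₁ level | no ≢d = ⊥-elim (≢d (≡.trans level deg≡d))
      ... | inj₂ κ≈0   | no _  = trans (*-congˡ κ≈0) (trans (zeroʳ _) (sym (trans (*-congˡ κ≈0) (zeroʳ _))))
    byDegree (no deg≢d) = begin
      shiftCoeff w φ (homog d ((a , f) ∷ p)) e
        ≡⟨ ≡.cong (λ q → shiftCoeff w φ q e) (homog-reject d a f p deg≢d) ⟩
      shiftCoeff w φ (homog d p) e             ≈⟨ shiftCoeff-homog w φ d p e ⟩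
      shiftCoeff w (λ k → χ k * φ k) p e       ≈⟨ +-identityˡ _ ⟨
      0# + shiftCoeff w (λ k → χ k * φ k) p e  ≈⟨ +-congʳ (trans (*-congˡ dropped) (zeroʳ a)) ⟨
      a * ((χ g * φ g) * κ) + shiftCoeff w (λ k → χ k * φ k) p e ∎
      where
      dropped : (χ g * φ g) * κ ≈ 0#
      dropped with shiftKernel-degree w f e | degree e ℕ.+ g ℕ.≟ d
      ... | _          | no _   = trans (*-congʳ (zeroˡ _)) (zeroˡ _)
      ... | inj₁ level | yes ≡d = ⊥-elim (deg≢d (≡.trans (≡.sym level) ≡d))
      ... | inj₂ κ≈0   | yes _  = trans (*-congˡ κ≈0) (zeroʳ _)

  shiftCoeff-derivMono : ∀ {n} (w : Fin n → Carrier) φ i a (f e : Vec ℕ n) →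
    shiftCoeff w φ (derivMono i (a , f)) e ≈
    suc (lookup e i) × (a * (φ (gap f (e [ i ]%= suc)) * shiftKernel w f (e [ i ]%= suc)))
  shiftCoeff-derivMono w φ i a f e with lookup f i in fᵢ≡
  ... | zero = sym (begin
    s × (a * (φ (gap f e′) * shiftKernel w f e′))
      ≈⟨ ×-congʳ s (*-congˡ (*-congˡ (shiftKernel-[]%=suc w i f e fᵢ≡))) ⟩
    s × (a * (φ (gap f e′) * 0#))                  ≈⟨ ×-congʳ s (trans (*-congˡ (zeroʳ _)) (zeroʳ a)) ⟩
    s × 0#                                         ≈⟨ ×-zeroʳ s ⟩
    0#                                             ∎)
    where
    s = suc (lookup e i)
    e′ = e [ i ]%= suc
  ... | suc k = begin
    natMul (suc k) a * (φ (gap (f [ i ]≔ k) e) * shiftKernel w (f [ i ]≔ k) e) + 0#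
      ≈⟨ trans (+-identityʳ _) (*-congʳ (reflexive (natMul≡× (suc k) a))) ⟩
    (suc k × a) * (φ (gap (f [ i ]≔ k) e) * shiftKernel w (f [ i ]≔ k) e)
      ≈⟨ trans (×-assoc-* (suc k) a _) (×-inner (suc k) a _ _) ⟩
    a * (φ (gap (f [ i ]≔ k) e) * (suc k × shiftKernel w (f [ i ]≔ k) e))
      ≈⟨ *-congˡ (*-cong (reflexive (≡.cong φ (gap-[]≔ f e i fᵢ≡))) (shiftKernel-raise w i f e fᵢ≡)) ⟩
    a * (φ (gap f e′) * (s × shiftKernel w f e′))
      ≈⟨ ×-inner s a _ _ ⟨
    s × (a * (φ (gap f e′) * shiftKernel w f e′)) ∎
    where
    s = suc (lookup e i)
    e′ = e [ i ]%= suc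

  shiftCoeff-∂ : ∀ {n} (w : Fin n → Carrier) φ i p e →
    shiftCoeff w φ (∂ i p) e ≈ suc (lookup e i) × shiftCoeff w φ p (e [ i ]%= suc)
  shiftCoeff-∂ w φ i []            e = sym (×-zeroʳ (suc (lookup e i)))
  shiftCoeff-∂ w φ i ((a , f) ∷ p) e = begin
    shiftCoeff w φ (derivMono i (a , f) +P ∂ i p) e
      ≈⟨ shiftCoeff-+P w φ (derivMono i (a , f)) (∂ i p) e ⟩
    shiftCoeff w φ (derivMono i (a , f)) e + shiftCoeff w φ (∂ i p) e
      ≈⟨ +-cong (shiftCoeff-derivMono w φ i a f e) (shiftCoeff-∂ w φ i p e) ⟩
    s × (a * (φ (gap f e′) * shiftKernel w f e′)) + s × shiftCoeff w φ p e′
      ≈⟨ ×-distrib-+ _ _ s ⟨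
    s × shiftCoeff w φ ((a , f) ∷ p) e′ ∎
    where
    s = suc (lookup e i)
    e′ = e [ i ]%= suc

  coeff-∂ : ∀ {n} i (p : Poly n) e → coeff (∂ i p) e ≈ suc (lookup e i) × coeff p (e [ i ]%= suc)
  coeff-∂ i p e = begin
    coeff (∂ i p) e                                         ≈⟨ coeff≈shiftCoeff-atZero w₀ (∂ i p) e ⟩
    shiftCoeff w₀ atZero (∂ i p) e                          ≈⟨ shiftCoeff-∂ w₀ atZero i p e ⟩
    suc (lookup e i) × shiftCoeff w₀ atZero p (e [ i ]%= suc)
      ≈⟨ ×-congʳ (suc (lookup e i)) (coeff≈shiftCoeff-atZero w₀ p _) ⟨
    suc (lookup e i) × coeff p (e [ i ]%= suc)              ∎
    where
    -- Any shift would do: only the level-0 part, which is p itself, is used.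
    w₀ = λ _ → 0#

  coeff-∂Δ : ∀ {n} (M : Fin n → Fin n → Carrier) i p e →
    coeff (∂ i (Δ M i p)) e ≈ shiftCoeff (λ j → - M i j) aboveZero (∂ i p) e
  coeff-∂Δ M i p e = begin
    coeff (∂ i (Δ M i p)) e                                   ≈⟨ coeff-∂ i (Δ M i p) e ⟩
    suc (lookup e i) × coeff (Δ M i p) (e [ i ]%= suc)
      ≈⟨ ×-congʳ (suc (lookup e i)) (coeff-Δ M i p _) ⟩
    suc (lookup e i) × shiftCoeff w aboveZero p (e [ i ]%= suc) ≈⟨ shiftCoeff-∂ w aboveZero i p e ⟨
    shiftCoeff w aboveZero (∂ i p) e                          ∎
    where w = λ j → - M i j

  -- The coefficient function of Σⱼ wⱼ ∂ⱼ r, for r given by its coefficient function.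
  derivAlong : ∀ {n} → (Fin n → Carrier) → (Vec ℕ n → Carrier) → Vec ℕ n → Carrier
  derivAlong {n} w r e = ∑[ j < n ] (w j * (suc (lookup e j) × r (e [ j ]%= suc)))

  derivAlong-vanishes : ∀ {n} (w : Fin n → Carrier) r → (∀ e → r e ≈ 0#) → ∀ e → derivAlong w r e ≈ 0#
  derivAlong-vanishes {n} w r r≈0 e = trans (sum-cong-≋ λ j → begin
    w j * (suc (lookup e j) × r (e [ j ]%= suc)) ≈⟨ *-congˡ (×-congʳ (suc (lookup e j)) (r≈0 _)) ⟩
    w j * (suc (lookup e j) × 0#)                ≈⟨ *-congˡ (×-zeroʳ (suc (lookup e j))) ⟩
    w j * 0#                                     ≈⟨ zeroʳ (w j) ⟩
    0#                                           ∎)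
    (sum-replicate-zero n)

  derivAlong-linear : ∀ {n} (w : Fin n → Carrier) a r s e →
    derivAlong w (λ e → a * r e + s e) e ≈ a * derivAlong w r e + derivAlong w s e
  derivAlong-linear {n} w a r s e = begin
    ∑[ j < n ] (w j * (m j × (a * r (up j) + s (up j))))
      ≈⟨ sum-cong-≋ distribute ⟩
    ∑[ j < n ] (a * (w j * (m j × r (up j))) + w j * (m j × s (up j)))
      ≈⟨ ∑-distrib-+ (λ j → a * (w j * (m j × r (up j)))) (λ j → w j * (m j × s (up j))) ⟩
    ∑[ j < n ] (a * (w j * (m j × r (up j)))) + derivAlong w s e
      ≈⟨ +-congʳ (*-distribˡ-sum a (λ j → w j * (m j × r (up j)))) ⟨
    a * derivAlong w r e + derivAlong w s e ∎
    where
    m = λ j → suc (lookup e j)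
    up = λ j → e [ j ]%= suc
    distribute : ∀ j →
      w j * (m j × (a * r (up j) + s (up j))) ≈ a * (w j * (m j × r (up j))) + w j * (m j × s (up j))
    distribute j = begin
      w j * (m j × (a * r (up j) + s (up j)))          ≈⟨ *-congˡ (×-distrib-+ _ _ (m j)) ⟩
      w j * (m j × (a * r (up j)) + m j × s (up j))    ≈⟨ *-congˡ (+-congʳ (×-comm-* (m j) a _)) ⟨
      w j * (a * (m j × r (up j)) + m j × s (up j))    ≈⟨ distribˡ (w j) _ _ ⟩
      w j * (a * (m j × r (up j))) + w j * (m j × s (up j))
        ≈⟨ +-congʳ (x∙yz≈y∙xz (w j) a _) ⟩
      a * (w j * (m j × r (up j))) + w j * (m j × s (up j)) ∎

  ∑-∸-× : ∀ {n} (f e : Vec ℕ n) x → ∑[ j < n ] ((lookup f j ∸ lookup e j) × x) ≈ gap f e × x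
  ∑-∸-× []      []      x = refl
  ∑-∸-× (F ∷ f) (y ∷ e) x = trans (+-congˡ (∑-∸-× f e x)) (sym (×-homo-+ x (F ∸ y) (gap f e)))

  derivAlong-kernel-term : ∀ {n} (w : Fin n → Carrier) (φ : ℕ → Carrier) (f e : Vec ℕ n) j →
    w j * (suc (lookup e j) × (φ (gap f (e [ j ]%= suc)) * shiftKernel w f (e [ j ]%= suc)))
      ≈ φ (gap f e ∸ 1) * ((lookup f j ∸ lookup e j) × shiftKernel w f e)
  derivAlong-kernel-term w φ f e j = begin
    w j * (s × (φ g′ * shiftKernel w f e′))  ≈⟨ *-congˡ (×-comm-* s (φ g′) _) ⟨
    w j * (φ g′ * (s × shiftKernel w f e′))  ≈⟨ x∙yz≈y∙xz (w j) (φ g′) _ ⟩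
    φ g′ * (w j * (s × shiftKernel w f e′))  ≈⟨ *-congˡ (shiftKernel-lower w f e j) ⟩
    φ g′ * (d × shiftKernel w f e)           ≈⟨ levelDrop ⟩
    φ (gap f e ∸ 1) * (d × shiftKernel w f e) ∎
    where
    s = suc (lookup e j)
    e′ = e [ j ]%= suc
    g′ = gap f e′
    d = lookup f j ∸ lookup e j
    levelDrop : φ g′ * (d × shiftKernel w f e) ≈ φ (gap f e ∸ 1) * (d × shiftKernel w f e)
    levelDrop with lookup e j ℕ.<? lookup f j
    ... | yes eⱼ<fⱼ = reflexive (≡.cong (λ k → φ (ℕ.pred k) * (d × shiftKernel w f e)) (gap-[]%=suc f e j eⱼ<fⱼ))
    ... | no eⱼ≮fⱼ  = trans (*-congˡ d×K≈0) (trans (zeroʳ _) (sym (trans (*-congˡ d×K≈0) (zeroʳ _))))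
      where
      d×K≈0 : d × shiftKernel w f e ≈ 0#
      d×K≈0 = ×-congˡ (ℕ.m≤n⇒m∸n≡0 (ℕ.≮⇒≥ eⱼ≮fⱼ))

  derivAlong-kernel : ∀ {n} (w : Fin n → Carrier) (φ : ℕ → Carrier) (f e : Vec ℕ n) →
    derivAlong w (λ e → φ (gap f e) * shiftKernel w f e) e ≈ raise φ (gap f e) * shiftKernel w f e
  derivAlong-kernel {n} w φ f e = begin
    derivAlong w (λ e → φ (gap f e) * shiftKernel w f e) e
      ≈⟨ sum-cong-≋ (derivAlong-kernel-term w φ f e) ⟩
    ∑[ j < n ] (φ (gap f e ∸ 1) * ((lookup f j ∸ lookup e j) × shiftKernel w f e))
      ≈⟨ *-distribˡ-sum (φ (gap f e ∸ 1)) (λ j → (lookup f j ∸ lookup e j) × shiftKernel w f e) ⟨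
    φ (gap f e ∸ 1) * ∑[ j < n ] ((lookup f j ∸ lookup e j) × shiftKernel w f e)
      ≈⟨ *-congˡ (∑-∸-× f e (shiftKernel w f e)) ⟩
    φ (gap f e ∸ 1) * (gap f e × shiftKernel w f e)
      ≈⟨ trans (×-comm-* (gap f e) _ _) (sym (×-assoc-* (gap f e) _ _)) ⟩
    raise φ (gap f e) * shiftKernel w f e ∎

  derivAlong-shiftCoeff : ∀ {n} (w : Fin n → Carrier) φ p e →
    derivAlong w (shiftCoeff w φ p) e ≈ shiftCoeff w (raise φ) p e
  derivAlong-shiftCoeff w φ []            e = derivAlong-vanishes w (λ _ → 0#) (λ _ → refl) e
  derivAlong-shiftCoeff w φ ((a , f) ∷ p) e =
    trans (derivAlong-linear w a (λ e → φ (gap f e) * shiftKernel w f e) (shiftCoeff w φ p) e)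
          (+-cong (*-congˡ (derivAlong-kernel w φ f e)) (derivAlong-shiftCoeff w φ p e))

  shiftCoeff-vanishes : CharZero → ∀ {n} (w : Fin n → Carrier) q →
    (∀ e → shiftCoeff w aboveZero q e ≈ 0#) → ∀ φ → φ 0 ≈ 0# → ∀ e → shiftCoeff w φ q e ≈ 0#
  shiftCoeff-vanishes charZero w q = LevelVanishing.𝒯-vanishes-at-zero charZero
    (λ φ → shiftCoeff w φ q)
    (λ φ ψ β → shiftCoeff-linear w φ ψ β q)
    (degreeSum q) (shiftCoeff-bounded w q)
    (λ φ 𝒯φ≈0 e → trans (sym (derivAlong-shiftCoeff w φ q e))
                         (derivAlong-vanishes w (shiftCoeff w φ q) 𝒯φ≈0 e))

proposition2p5 : ∀ {c ℓ} (K : Field c ℓ) → FieldOps.CharZero K →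
    (n : ℕ) → 1 ≤ n → (M : Fin n → Fin n → Field.Carrier K) →
    FieldOps.Graded K (FieldOps.InΔ K M)
proposition2p5 K charZero n _ M p p∈Δ m i e = begin
  coeff (∂ i (Δ M i (homog m p))) e           ≈⟨ coeff-∂Δ M i (homog m p) e ⟩
  shiftCoeff w aboveZero (∂ i (homog m p)) e  ≈⟨ shiftCoeff-∂ w aboveZero i (homog m p) e ⟩
  s × shiftCoeff w aboveZero (homog m p) e′   ≈⟨ ×-congʳ s (shiftCoeff-homog w aboveZero m p e′) ⟩
  s × shiftCoeff w χ p e′                     ≈⟨ shiftCoeff-∂ w χ i p e ⟨
  shiftCoeff w χ (∂ i p) e
    ≈⟨ shiftCoeff-vanishes charZero w (∂ i p) ∂p-invariant χ (zeroʳ _) e ⟩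
  0#                                          ∎
  where
  open Field K hiding (zero)
  open FieldOps K
  open Polynomials K
  open import Algebra.Properties.Semiring.Mult semiring using (_×_; ×-congʳ)
  open import Relation.Binary.Reasoning.Setoid setoid
  w = λ j → - M i j
  s = suc (lookup e i)
  e′ = e [ i ]%= suc
  χ = λ k → ⟦ degree e′ ℕ.+ k ℕ.≟ m ⟧ * aboveZero k
  ∂p-invariant : ∀ e → shiftCoeff w aboveZero (∂ i p) e ≈ 0#
  ∂p-invariant e = trans (sym (coeff-∂Δ M i p e)) (p∈Δ i e)
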